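{- Let $(t(n))_{n\ge0}$ be the Thue–Morse sequence, defined by $t(0)=0$, $t(2n)=t(n)$, $t(2n+1)=1-t(n)$. Let $(a(n))_{n\ge0}$ be the increasing enumeration (indexed from $0$) of the odious numbers (nonnegative integers with odd binary digit sum) and $(b(n))_{n\ge0}$ that of the evil numbers (nonnegative integers with even binary digit sum). Let $S(n)=\sum_{k=0}^n a(k)$ and $R(n)=\sum_{k=0}^n b(k)$. Then for all $n\ge0$: (1) $a(n)=2n+1-t(n)$; (2) $b(n)=2n+t(n)$; (3) $S(n)=n^2+\frac{3n}{2}+\frac12+\frac{1+(-1)^n}{4}(1-2t(n))$, i.e. $S(n)=n^2+\frac{3n}{2}+\frac12$ if $n$ is odd and $S(n)=n^2+\frac{3n}{2}+1-t(n)$ if $n$ is even; (4) $R(n)=n^2+\frac{3n}{2}+\frac12+\frac{1+(-1)^n}{4}(2t(n)-1)$, i.e. $R(n)=n^2+\frac{3n}{2}+\frac12$ if $n$ is odd and $R(n)=n^2+\frac{3n}{2}+t(n)$ if $n$ is even. -}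

module Defs where

open import Data.Nat using (ℕ; zero; suc; _+_; _*_; _∸_; _<_; _%_; _/_)
open import Data.Product using (∃; _×_)
open import Function.Bundles using (_⇔_)
open import Relation.Binary.PropositionalEquality using (_≡_)

-- Binary digit sum, computed with fuel: at each step add the last binary
-- digit (n % 2) and shift right (n / 2).  Fuel n suffices for n, since
-- n / 2 < n for n > 0 and the digit sum of 0 is 0.
digitSumFuel : ℕ → ℕ → ℕ
digitSumFuel zero    n = 0
digitSumFuel (suc f) n = n % 2 + digitSumFuel f (n / 2)

binDigitSum : ℕ → ℕ
binDigitSum n = digitSumFuel n n

Odious : ℕ → Set
Odious n = binDigitSum n % 2 ≡ 1

Evil : ℕ → Set
Evil n = binDigitSum n % 2 ≡ 0

-- The Thue–Morse recurrence: t(0)=0, t(2n)=t(n), t(2n+1)=1-t(n).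
-- (It determines t uniquely, with values in {0,1}.)
IsThueMorse : (ℕ → ℕ) → Set
IsThueMorse t = (t 0 ≡ 0) × (∀ n → t (2 * n) ≡ t n) × (∀ n → t (suc (2 * n)) ≡ 1 ∸ t n)

IncreasingEnumeration : (ℕ → Set) → (ℕ → ℕ) → Set
IncreasingEnumeration P e = (∀ i j → i < j → e i < e j) × (∀ m → P m ⇔ ∃ λ k → e k ≡ m)

sumUpTo : (ℕ → ℕ) → ℕ → ℕ
sumUpTo f zero    = f 0
sumUpTo f (suc n) = sumUpTo f n + f (suc n)

{-# OPTIONS --safe #-}
-- The parity of the binary digit sum satisfies the Thue–Morse recurrence, which
-- determines its solution, so t(n) is that parity.  As t(2k+1) = 1 - t(2k), each
-- pair {2k, 2k+1} holds exactly one odious and one evil number, namely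
-- 2k + 1 - t(k) and 2k + t(k); an increasing enumeration being unique, these are
-- a(k) and b(k).  Summing, R(n) = n(n+1) + T(n) and S(n) + T(n) = (n+1)², where
-- T(n) = t(0) + ... + t(n); grouping T into the pairs gives T(2m+1) = m + 1 and
-- T(2m) = m + t(m), from which the closed forms follow.
module Submission where

open import Defs
open import Data.Nat as ℕ using (ℕ; zero; suc; _∸_; _≤_; _<_; _%_; _/_; z≤n; s≤s)
open import Data.Nat.Properties
  using (≤-refl; ≤-antisym; ≤-trans; <-trans; <-irrefl; ≤-pred; <⇒≤; ≮⇒≥; _<?_;
         m≤m+n; *-suc; *-comm; +-comm; +-assoc; +-identityʳ; m<m+n; m≤n⇒m<n∨m≡n; n≤1⇒n≡0∨n≡1;
         +-monoʳ-≤; +-commutativeSemigroup; m∸n+n≡m; m∸n≤m; m+[n∸m]≡n; module ≤-Reasoning)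
open import Data.Nat.Tactic.RingSolver using () renaming (solve-∀ to ℕ-solve-∀)
open import Algebra.Properties.CommutativeSemigroup +-commutativeSemigroup using (interchange)
open import Data.Nat.DivMod using (m/n<m; m*n%n≡0; m*n/n≡m; [m+kn]%n≡m%n; +-distrib-/; m%n<n)
open import Data.Nat.Induction using (<-rec)
open import Data.Integer using (ℤ; +_; _+_; _-_; -_; _*_; _^_; -1ℤ)
open import Data.Integer.Properties as ℤ using (pos-*; ^-*-assoc; ^-zeroˡ; ⊖-≥; m-n≡m⊖n)
open import Data.Integer.Tactic.RingSolver using (solve-∀)
open import Data.Product using (_×_; _,_; ∃; proj₁; proj₂)
open import Data.Sum using (inj₁; inj₂)
open import Function.Base using (_∘_)
open import Function.Bundles using (_⇔_; mk⇔; Equivalence)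
import Function.Properties.Equivalence as ⇔
open import Relation.Binary.PropositionalEquality
open import Relation.Nullary using (yes; no; contradiction)

data EvenOrOdd : ℕ → Set where
  even : ∀ k → EvenOrOdd (2 ℕ.* k)
  odd  : ∀ k → EvenOrOdd (suc (2 ℕ.* k))

evenOrOdd : ∀ n → EvenOrOdd n
evenOrOdd zero = even 0
evenOrOdd (suc n) with evenOrOdd n
... | even k = odd k
... | odd k = subst EvenOrOdd (*-suc 2 k) (even (suc k))

digitSumFuel-zero : ∀ f → digitSumFuel f 0 ≡ 0
digitSumFuel-zero zero = refl
digitSumFuel-zero (suc f) = digitSumFuel-zero f

n≤1+f⇒n/2≤f : ∀ {n f} → n ≤ suc f → n / 2 ≤ f
n≤1+f⇒n/2≤f {zero} _ = z≤n
n≤1+f⇒n/2≤f {suc n} n≤1+f = ≤-pred (≤-trans (m/n<m (suc n) 2 (s≤s (s≤s z≤n))) n≤1+f)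

digitSumFuel-irrelevant : ∀ {f g n} → n ≤ f → n ≤ g → digitSumFuel f n ≡ digitSumFuel g n
digitSumFuel-irrelevant {zero} {g} z≤n _ = sym (digitSumFuel-zero g)
digitSumFuel-irrelevant {suc f} {zero} _ z≤n = digitSumFuel-zero (suc f)
digitSumFuel-irrelevant {suc f} {suc g} {n} n≤f n≤g =
  cong (n % 2 ℕ.+_) (digitSumFuel-irrelevant (n≤1+f⇒n/2≤f n≤f) (n≤1+f⇒n/2≤f n≤g))

binDigitSum-step : ∀ n → binDigitSum n ≡ n % 2 ℕ.+ binDigitSum (n / 2)
binDigitSum-step zero = refl
binDigitSum-step (suc n) = cong (suc n % 2 ℕ.+_) (digitSumFuel-irrelevant (n≤1+f⇒n/2≤f {f = n} ≤-refl) ≤-refl)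

2*k%2≡0 : ∀ k → 2 ℕ.* k % 2 ≡ 0
2*k%2≡0 k = trans (cong (_% 2) (*-comm 2 k)) (m*n%n≡0 k 2)

2*k/2≡k : ∀ k → 2 ℕ.* k / 2 ≡ k
2*k/2≡k k = trans (cong (_/ 2) (*-comm 2 k)) (m*n/n≡m k 2)

1+2*k%2≡1 : ∀ k → suc (2 ℕ.* k) % 2 ≡ 1
1+2*k%2≡1 k = trans (cong (λ m → suc m % 2) (*-comm 2 k)) ([m+kn]%n≡m%n 1 k 2)

1+2*k/2≡k : ∀ k → suc (2 ℕ.* k) / 2 ≡ k
1+2*k/2≡k k = begin
  (1 ℕ.+ 2 ℕ.* k) / 2  ≡⟨ +-distrib-/ 1 (2 ℕ.* k) (subst (λ r → 1 ℕ.+ r < 2) (sym (2*k%2≡0 k)) ≤-refl) ⟩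
  0 ℕ.+ 2 ℕ.* k / 2    ≡⟨ 2*k/2≡k k ⟩
  k                    ∎
  where open ≡-Reasoning

binDigitSum-double : ∀ k → binDigitSum (2 ℕ.* k) ≡ binDigitSum k
binDigitSum-double k = begin
  binDigitSum (2 ℕ.* k)                                 ≡⟨ binDigitSum-step (2 ℕ.* k) ⟩
  2 ℕ.* k % 2 ℕ.+ binDigitSum (2 ℕ.* k / 2)           ≡⟨ cong₂ ℕ._+_ (2*k%2≡0 k) (cong binDigitSum (2*k/2≡k k)) ⟩
  binDigitSum k                                         ∎
  where open ≡-Reasoning

binDigitSum-suc-double : ∀ k → binDigitSum (suc (2 ℕ.* k)) ≡ suc (binDigitSum k)
binDigitSum-suc-double k = begin
  binDigitSum (suc (2 ℕ.* k))                                   ≡⟨ binDigitSum-step (suc (2 ℕ.* k)) ⟩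
  suc (2 ℕ.* k) % 2 ℕ.+ binDigitSum (suc (2 ℕ.* k) / 2)       ≡⟨ cong₂ ℕ._+_ (1+2*k%2≡1 k) (cong binDigitSum (1+2*k/2≡k k)) ⟩
  suc (binDigitSum k)                                           ∎
  where open ≡-Reasoning

suc-%2 : ∀ m → suc m % 2 ≡ 1 ∸ m % 2
suc-%2 zero = refl
suc-%2 (suc zero) = refl
suc-%2 (suc (suc m)) = suc-%2 m

digitParity-isThueMorse : IsThueMorse (λ n → binDigitSum n % 2)
digitParity-isThueMorse =
  refl ,
  (λ k → cong (_% 2) (binDigitSum-double k)) ,
  (λ k → trans (cong (_% 2) (binDigitSum-suc-double k)) (suc-%2 (binDigitSum k)))

IsThueMorse-unique : ∀ {t u} → IsThueMorse t → IsThueMorse u → ∀ n → t n ≡ u n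
IsThueMorse-unique {t} {u} (t0 , t-even , t-odd) (u0 , u-even , u-odd) = <-rec _ agree
  where
  agree : ∀ n → (∀ {m} → m < n → t m ≡ u m) → t n ≡ u n
  agree n ih with evenOrOdd n
  ... | even zero = trans t0 (sym u0)
  ... | even k@(suc _) = trans (t-even k) (trans (ih (m<m+n k (s≤s z≤n))) (sym (u-even k)))
  ... | odd k = trans (t-odd k) (trans (cong (1 ∸_) (ih (s≤s (m≤m+n k _)))) (sym (u-odd k)))

StrictlyIncreasing : (ℕ → ℕ) → Set
StrictlyIncreasing e = ∀ i j → i < j → e i < e j

strictlyIncreasing-step : ∀ {e} → (∀ k → e k < e (suc k)) → StrictlyIncreasing e
strictlyIncreasing-step e-step i (suc j) i<1+j with m≤n⇒m<n∨m≡n (≤-pred i<1+j)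
... | inj₁ i<j = <-trans (strictlyIncreasing-step e-step i j i<j) (e-step j)
... | inj₂ refl = e-step i

strictlyIncreasing⇒monotone : ∀ {e} → StrictlyIncreasing e → ∀ {i j} → i ≤ j → e i ≤ e j
strictlyIncreasing⇒monotone e-inc {i} {j} i≤j with m≤n⇒m<n∨m≡n i≤j
... | inj₁ i<j = <⇒≤ (e-inc i j i<j)
... | inj₂ refl = ≤-refl

_Covers_ : (ℕ → ℕ) → (ℕ → ℕ) → Set
f Covers e = ∀ k → ∃ λ j → f j ≡ e k

-- e n is some value f j, and j < n is excluded because e and f agree below n.
covered-values⇒≤ : ∀ {e f} → StrictlyIncreasing e → StrictlyIncreasing f
  → f Covers e → ∀ n → (∀ {i} → i < n → f i ≡ e i) → f n ≤ e n
covered-values⇒≤ e-inc f-inc covered n agree with covered n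
... | j , fj≡en with j <? n
...   | yes j<n = contradiction (e-inc j n j<n) (<-irrefl (trans (sym (agree j<n)) fj≡en))
...   | no j≮n = subst (_ ≤_) fj≡en (strictlyIncreasing⇒monotone f-inc (≮⇒≥ j≮n))

IncreasingEnumeration-unique : ∀ {P e f} → IncreasingEnumeration P e → IncreasingEnumeration P f
  → ∀ n → e n ≡ f n
IncreasingEnumeration-unique {e = e} {f} (e-inc , e-image) (f-inc , f-image) = <-rec _ agree
  where
  f-covers-e : f Covers e
  f-covers-e k = Equivalence.to (f-image (e k)) (Equivalence.from (e-image (e k)) (k , refl))
  e-covers-f : e Covers f
  e-covers-f k = Equivalence.to (e-image (f k)) (Equivalence.from (f-image (f k)) (k , refl))
  agree : ∀ n → (∀ {i} → i < n → e i ≡ f i) → e n ≡ f n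
  agree n ih = ≤-antisym (covered-values⇒≤ f-inc e-inc e-covers-f n ih)
                         (covered-values⇒≤ e-inc f-inc f-covers-e n (sym ∘ ih))

increasingEnumeration-onePerPair : (P : ℕ → Set) (c : ℕ → ℕ) → (∀ k → c k ≤ 1)
  → (∀ k → P (2 ℕ.* k) ⇔ c k ≡ 0) → (∀ k → P (suc (2 ℕ.* k)) ⇔ c k ≡ 1)
  → IncreasingEnumeration P (λ k → 2 ℕ.* k ℕ.+ c k)
increasingEnumeration-onePerPair P c c≤1 P-even P-odd = increasing , λ m → mk⇔ (enumerates m) (member m)
  where
  e : ℕ → ℕ
  e k = 2 ℕ.* k ℕ.+ c k

  increasing : StrictlyIncreasing e
  increasing = strictlyIncreasing-step λ k → begin-strict
    2 ℕ.* k ℕ.+ c k        ≤⟨ +-monoʳ-≤ (2 ℕ.* k) (c≤1 k) ⟩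
    2 ℕ.* k ℕ.+ 1          ≡⟨ +-comm (2 ℕ.* k) 1 ⟩
    suc (2 ℕ.* k)          <⟨ ≤-refl ⟩
    suc (suc (2 ℕ.* k))    ≡⟨ *-suc 2 k ⟨
    2 ℕ.* suc k            ≤⟨ m≤m+n _ _ ⟩
    e (suc k)              ∎
    where open ≤-Reasoning

  enumerates : ∀ m → P m → ∃ λ k → e k ≡ m
  enumerates m Pm with evenOrOdd m
  ... | even k = k , trans (cong (2 ℕ.* k ℕ.+_) (Equivalence.to (P-even k) Pm)) (+-identityʳ _)
  ... | odd k = k , trans (cong (2 ℕ.* k ℕ.+_) (Equivalence.to (P-odd k) Pm)) (+-comm _ 1)

  e-in-P : ∀ k → P (e k)
  e-in-P k with n≤1⇒n≡0∨n≡1 (c≤1 k)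
  ... | inj₁ ck≡0 = subst P (sym (trans (cong (2 ℕ.* k ℕ.+_) ck≡0) (+-identityʳ _)))
                            (Equivalence.from (P-even k) ck≡0)
  ... | inj₂ ck≡1 = subst P (sym (trans (cong (2 ℕ.* k ℕ.+_) ck≡1) (+-comm _ 1)))
                            (Equivalence.from (P-odd k) ck≡1)

  member : ∀ m → (∃ λ k → e k ≡ m) → P m
  member m (k , ek≡m) = subst P ek≡m (e-in-P k)

sumUpTo-cong : ∀ {f g} → (∀ k → f k ≡ g k) → ∀ n → sumUpTo f n ≡ sumUpTo g n
sumUpTo-cong f≗g zero = f≗g 0
sumUpTo-cong f≗g (suc n) = cong₂ ℕ._+_ (sumUpTo-cong f≗g n) (f≗g (suc n))

sumUpTo-+ : ∀ f g n → sumUpTo (λ k → f k ℕ.+ g k) n ≡ sumUpTo f n ℕ.+ sumUpTo g n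
sumUpTo-+ f g zero = refl
sumUpTo-+ f g (suc n) = begin
  sumUpTo (λ k → f k ℕ.+ g k) n ℕ.+ (f (suc n) ℕ.+ g (suc n))
    ≡⟨ cong (ℕ._+ (f (suc n) ℕ.+ g (suc n))) (sumUpTo-+ f g n) ⟩
  (sumUpTo f n ℕ.+ sumUpTo g n) ℕ.+ (f (suc n) ℕ.+ g (suc n))
    ≡⟨ interchange (sumUpTo f n) (sumUpTo g n) (f (suc n)) (g (suc n)) ⟩
  (sumUpTo f n ℕ.+ f (suc n)) ℕ.+ (sumUpTo g n ℕ.+ g (suc n)) ∎
  where open ≡-Reasoning

sumUpTo-one : ∀ n → sumUpTo (λ _ → 1) n ≡ suc n
sumUpTo-one zero = refl
sumUpTo-one (suc n) = trans (cong (ℕ._+ 1) (sumUpTo-one n)) (+-comm (suc n) 1)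

sumUpTo-double : ∀ n → sumUpTo (2 ℕ.*_) n ≡ n ℕ.* suc n
sumUpTo-double zero = refl
sumUpTo-double (suc n) = trans (cong (ℕ._+ 2 ℕ.* suc n) (sumUpTo-double n)) (gauss-step n)
  where
  gauss-step : ∀ n → n ℕ.* suc n ℕ.+ 2 ℕ.* suc n ≡ suc n ℕ.* suc (suc n)
  gauss-step = ℕ-solve-∀

sumUpTo-pairs : ∀ f m → sumUpTo f (suc (2 ℕ.* m)) ≡ sumUpTo (λ k → f (2 ℕ.* k) ℕ.+ f (suc (2 ℕ.* k))) m
sumUpTo-pairs f zero = refl
sumUpTo-pairs f (suc m) = begin
  sumUpTo f (suc (2 ℕ.* suc m))
    ≡⟨ cong (λ j → sumUpTo f (suc j)) (*-suc 2 m) ⟩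
  (sumUpTo f (suc (2 ℕ.* m)) ℕ.+ f (suc (suc (2 ℕ.* m)))) ℕ.+ f (suc (suc (suc (2 ℕ.* m))))
    ≡⟨ +-assoc (sumUpTo f (suc (2 ℕ.* m))) _ _ ⟩
  sumUpTo f (suc (2 ℕ.* m)) ℕ.+ (f (suc (suc (2 ℕ.* m))) ℕ.+ f (suc (suc (suc (2 ℕ.* m)))))
    ≡⟨ cong₂ ℕ._+_ (sumUpTo-pairs f m) (cong (λ j → f j ℕ.+ f (suc j)) (sym (*-suc 2 m))) ⟩
  sumUpTo (λ k → f (2 ℕ.* k) ℕ.+ f (suc (2 ℕ.* k))) (suc m) ∎
  where open ≡-Reasoning

1∸x≡0⇔x≡1 : ∀ {x} → x ≤ 1 → (1 ∸ x ≡ 0) ⇔ (x ≡ 1)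
1∸x≡0⇔x≡1 z≤n = mk⇔ (λ ()) (λ ())
1∸x≡0⇔x≡1 (s≤s z≤n) = mk⇔ (λ _ → refl) (λ _ → refl)

-1^2k≡1 : ∀ k → -1ℤ ^ (2 ℕ.* k) ≡ + 1
-1^2k≡1 k = trans (sym (^-*-assoc -1ℤ 2 k)) (^-zeroˡ k)

module ThueMorse {t : ℕ → ℕ} (isThueMorse : IsThueMorse t) where

  private
    t-even : ∀ k → t (2 ℕ.* k) ≡ t k
    t-even = proj₁ (proj₂ isThueMorse)

    t-odd : ∀ k → t (suc (2 ℕ.* k)) ≡ 1 ∸ t k
    t-odd = proj₂ (proj₂ isThueMorse)

  t≡digitParity : ∀ n → t n ≡ binDigitSum n % 2
  t≡digitParity = IsThueMorse-unique isThueMorse digitParity-isThueMorse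

  t≤1 : ∀ n → t n ≤ 1
  t≤1 n = subst (_≤ 1) (sym (t≡digitParity n)) (≤-pred (m%n<n (binDigitSum n) 2))

  odious⇔t≡1 : ∀ m → Odious m ⇔ t m ≡ 1
  odious⇔t≡1 m = mk⇔ (trans (t≡digitParity m)) (trans (sym (t≡digitParity m)))

  evil⇔t≡0 : ∀ m → Evil m ⇔ t m ≡ 0
  evil⇔t≡0 m = mk⇔ (trans (t≡digitParity m)) (trans (sym (t≡digitParity m)))

  nthOdious : ℕ → ℕ
  nthOdious k = 2 ℕ.* k ℕ.+ (1 ∸ t k)

  nthEvil : ℕ → ℕ
  nthEvil k = 2 ℕ.* k ℕ.+ t k

  odious-enumeration : IncreasingEnumeration Odious nthOdious
  odious-enumeration = increasingEnumeration-onePerPair Odious (λ k → 1 ∸ t k) (λ k → m∸n≤m 1 (t k))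
    (λ k → ⇔.trans (subst (λ x → Odious (2 ℕ.* k) ⇔ x ≡ 1) (t-even k) (odious⇔t≡1 _))
                   (⇔.sym (1∸x≡0⇔x≡1 (t≤1 k))))
    (λ k → subst (λ x → Odious (suc (2 ℕ.* k)) ⇔ x ≡ 1) (t-odd k) (odious⇔t≡1 _))

  evil-enumeration : IncreasingEnumeration Evil nthEvil
  evil-enumeration = increasingEnumeration-onePerPair Evil t t≤1
    (λ k → subst (λ x → Evil (2 ℕ.* k) ⇔ x ≡ 0) (t-even k) (evil⇔t≡0 _))
    (λ k → ⇔.trans (subst (λ x → Evil (suc (2 ℕ.* k)) ⇔ x ≡ 0) (t-odd k) (evil⇔t≡0 _))
                   (1∸x≡0⇔x≡1 (t≤1 k)))

  t-pair-sum : ∀ k → t (2 ℕ.* k) ℕ.+ t (suc (2 ℕ.* k)) ≡ 1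
  t-pair-sum k = trans (cong₂ ℕ._+_ (t-even k) (t-odd k)) (m+[n∸m]≡n (t≤1 k))

  sumUpTo-t-odd : ∀ m → sumUpTo t (suc (2 ℕ.* m)) ≡ suc m
  sumUpTo-t-odd m = trans (sumUpTo-pairs t m) (trans (sumUpTo-cong t-pair-sum m) (sumUpTo-one m))

  sumUpTo-t-even : ∀ m → sumUpTo t (2 ℕ.* m) ≡ m ℕ.+ t m
  sumUpTo-t-even zero = refl
  sumUpTo-t-even (suc m) = begin
    sumUpTo t (2 ℕ.* suc m)                              ≡⟨ cong (sumUpTo t) (*-suc 2 m) ⟩
    sumUpTo t (suc (2 ℕ.* m)) ℕ.+ t (suc (suc (2 ℕ.* m))) ≡⟨ cong₂ ℕ._+_ (sumUpTo-t-odd m) (cong t (sym (*-suc 2 m))) ⟩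
    suc m ℕ.+ t (2 ℕ.* suc m)                            ≡⟨ cong (suc m ℕ.+_) (t-even (suc m)) ⟩
    suc m ℕ.+ t (suc m)                                  ∎
    where open ≡-Reasoning

  four-sumUpTo-t : ∀ n → + 4 * + sumUpTo t n
    ≡ + 2 * + n + + 1 - -1ℤ ^ n + (+ 1 + -1ℤ ^ n) * (+ 2 * + t n)
  four-sumUpTo-t n with evenOrOdd n
  ... | even k = begin
    + 4 * + sumUpTo t (2 ℕ.* k)
      ≡⟨ cong (λ T → + 4 * + T) (sumUpTo-t-even k) ⟩
    + 4 * (+ k + + t k)
      ≡⟨ even-identity (+ k) (+ t k) ⟩
    + 2 * (+ 2 * + k) + + 1 - + 1 + (+ 1 + + 1) * (+ 2 * + t k)
      ≡⟨ cong₂ (λ N τ → + 2 * N + + 1 - + 1 + (+ 1 + + 1) * (+ 2 * τ)) (pos-* 2 k) (cong +_ (t-even k)) ⟨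
    + 2 * + (2 ℕ.* k) + + 1 - + 1 + (+ 1 + + 1) * (+ 2 * + t (2 ℕ.* k))
      ≡⟨ cong (λ s → + 2 * + (2 ℕ.* k) + + 1 - s + (+ 1 + s) * (+ 2 * + t (2 ℕ.* k))) (-1^2k≡1 k) ⟨
    + 2 * + (2 ℕ.* k) + + 1 - -1ℤ ^ (2 ℕ.* k) + (+ 1 + -1ℤ ^ (2 ℕ.* k)) * (+ 2 * + t (2 ℕ.* k)) ∎
    where
    open ≡-Reasoning
    even-identity : ∀ k τ → + 4 * (k + τ) ≡ + 2 * (+ 2 * k) + + 1 - + 1 + (+ 1 + + 1) * (+ 2 * τ)
    even-identity = solve-∀
  ... | odd k = begin
    + 4 * + sumUpTo t (suc (2 ℕ.* k))
      ≡⟨ cong (λ T → + 4 * + T) (sumUpTo-t-odd k) ⟩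
    + 4 * (+ 1 + + k)
      ≡⟨ odd-identity (+ k) τ ⟩
    + 2 * (+ 1 + + 2 * + k) + + 1 - -1ℤ * + 1 + (+ 1 + -1ℤ * + 1) * (+ 2 * τ)
      ≡⟨ cong₂ (λ N s → + 2 * (+ 1 + N) + + 1 - -1ℤ * s + (+ 1 + -1ℤ * s) * (+ 2 * τ)) (pos-* 2 k) (-1^2k≡1 k) ⟨
    + 2 * + suc (2 ℕ.* k) + + 1 - -1ℤ ^ suc (2 ℕ.* k) + (+ 1 + -1ℤ ^ suc (2 ℕ.* k)) * (+ 2 * τ) ∎
    where
    open ≡-Reasoning
    τ = + t (suc (2 ℕ.* k))
    odd-identity : ∀ k τ → + 4 * (+ 1 + k) ≡ + 2 * (+ 1 + + 2 * k) + + 1 - -1ℤ * + 1 + (+ 1 + -1ℤ * + 1) * (+ 2 * τ)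
    odd-identity = solve-∀

  sumUpTo-nthEvil : ∀ n → sumUpTo nthEvil n ≡ n ℕ.* suc n ℕ.+ sumUpTo t n
  sumUpTo-nthEvil n = trans (sumUpTo-+ (2 ℕ.*_) t n) (cong (ℕ._+ sumUpTo t n) (sumUpTo-double n))

  sumUpTo-nthOdious+sumUpTo-t : ∀ n → sumUpTo nthOdious n ℕ.+ sumUpTo t n ≡ n ℕ.* suc n ℕ.+ suc n
  sumUpTo-nthOdious+sumUpTo-t n = begin
    sumUpTo nthOdious n ℕ.+ sumUpTo t n
      ≡⟨ cong (ℕ._+ sumUpTo t n) (sumUpTo-+ (2 ℕ.*_) (λ k → 1 ∸ t k) n) ⟩
    sumUpTo (2 ℕ.*_) n ℕ.+ sumUpTo (λ k → 1 ∸ t k) n ℕ.+ sumUpTo t n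
      ≡⟨ +-assoc (sumUpTo (2 ℕ.*_) n) _ _ ⟩
    sumUpTo (2 ℕ.*_) n ℕ.+ (sumUpTo (λ k → 1 ∸ t k) n ℕ.+ sumUpTo t n)
      ≡⟨ cong₂ ℕ._+_ (sumUpTo-double n) (sym (sumUpTo-+ (λ k → 1 ∸ t k) t n)) ⟩
    n ℕ.* suc n ℕ.+ sumUpTo (λ k → (1 ∸ t k) ℕ.+ t k) n
      ≡⟨ cong (n ℕ.* suc n ℕ.+_) (trans (sumUpTo-cong (λ k → m∸n+n≡m (t≤1 k)) n) (sumUpTo-one n)) ⟩
    n ℕ.* suc n ℕ.+ suc n ∎
    where open ≡-Reasoning

  four-sumUpTo-nthEvil : ∀ n → + 4 * + sumUpTo nthEvil n
    ≡ + 4 * (+ n * + n) + + 6 * + n + + 2 + (+ 1 + -1ℤ ^ n) * (+ 2 * + t n - + 1)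
  four-sumUpTo-nthEvil n = begin
    + 4 * + sumUpTo nthEvil n
      ≡⟨ cong (λ R → + 4 * + R) (sumUpTo-nthEvil n) ⟩
    + 4 * (+ (n ℕ.* suc n) + + sumUpTo t n)
      ≡⟨ ℤ.*-distribˡ-+ (+ 4) (+ (n ℕ.* suc n)) (+ sumUpTo t n) ⟩
    + 4 * + (n ℕ.* suc n) + + 4 * + sumUpTo t n
      ≡⟨ cong₂ (λ P F → + 4 * P + F) (pos-* n (suc n)) (four-sumUpTo-t n) ⟩
    + 4 * (+ n * (+ 1 + + n)) + (+ 2 * + n + + 1 - -1ℤ ^ n + (+ 1 + -1ℤ ^ n) * (+ 2 * + t n))
      ≡⟨ evil-identity (+ n) (-1ℤ ^ n) (+ t n) ⟩
    + 4 * (+ n * + n) + + 6 * + n + + 2 + (+ 1 + -1ℤ ^ n) * (+ 2 * + t n - + 1) ∎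
    where
    open ≡-Reasoning
    evil-identity : ∀ N s τ → + 4 * (N * (+ 1 + N)) + (+ 2 * N + + 1 - s + (+ 1 + s) * (+ 2 * τ))
                              ≡ + 4 * (N * N) + + 6 * N + + 2 + (+ 1 + s) * (+ 2 * τ - + 1)
    evil-identity = solve-∀

  four-sumUpTo-nthOdious : ∀ n → + 4 * + sumUpTo nthOdious n
    ≡ + 4 * (+ n * + n) + + 6 * + n + + 2 + (+ 1 + -1ℤ ^ n) * (+ 1 - + 2 * + t n)
  four-sumUpTo-nthOdious n = begin
    + 4 * S
      ≡⟨ complement S T ⟩
    + 4 * (S + T) - + 4 * T
      ≡⟨ cong (λ P → + 4 * P - + 4 * T) (cong +_ (sumUpTo-nthOdious+sumUpTo-t n)) ⟩
    + 4 * (+ (n ℕ.* suc n) + (+ 1 + + n)) - + 4 * T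
      ≡⟨ cong₂ (λ P F → + 4 * (P + (+ 1 + + n)) - F) (pos-* n (suc n)) (four-sumUpTo-t n) ⟩
    + 4 * (+ n * (+ 1 + + n) + (+ 1 + + n)) - (+ 2 * + n + + 1 - -1ℤ ^ n + (+ 1 + -1ℤ ^ n) * (+ 2 * + t n))
      ≡⟨ odious-identity (+ n) (-1ℤ ^ n) (+ t n) ⟩
    + 4 * (+ n * + n) + + 6 * + n + + 2 + (+ 1 + -1ℤ ^ n) * (+ 1 - + 2 * + t n) ∎
    where
    open ≡-Reasoning
    S T : ℤ
    S = + sumUpTo nthOdious n
    T = + sumUpTo t n
    complement : ∀ S T → + 4 * S ≡ + 4 * (S + T) - + 4 * T
    complement = solve-∀
    odious-identity : ∀ N s τ → + 4 * (N * (+ 1 + N) + (+ 1 + N)) - (+ 2 * N + + 1 - s + (+ 1 + s) * (+ 2 * τ))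
                                ≡ + 4 * (N * N) + + 6 * N + + 2 + (+ 1 + s) * (+ 1 - + 2 * τ)
    odious-identity = solve-∀

  nthOdious-ℤ : ∀ n → + nthOdious n ≡ + 2 * + n + + 1 - + t n
  nthOdious-ℤ n = begin
    + (2 ℕ.* n) + + (1 ∸ t n)      ≡⟨ cong₂ _+_ (pos-* 2 n) (sym (trans (m-n≡m⊖n 1 (t n)) (⊖-≥ (t≤1 n)))) ⟩
    + 2 * + n + (+ 1 - + t n)      ≡⟨ ℤ.+-assoc (+ 2 * + n) (+ 1) (- + t n) ⟨
    + 2 * + n + + 1 - + t n        ∎
    where open ≡-Reasoning

  nthEvil-ℤ : ∀ n → + nthEvil n ≡ + 2 * + n + + t n
  nthEvil-ℤ n = cong (_+ + t n) (pos-* 2 n)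

corollary3p3 : (t a b : ℕ → ℕ) → IsThueMorse t
    → IncreasingEnumeration Odious a → IncreasingEnumeration Evil b
    → (n : ℕ)
    → ((+ a n) ≡ + 2 * + n + + 1 - + t n)
      × ((+ b n) ≡ + 2 * + n + + t n)
      × (+ 4 * + sumUpTo a n ≡ + 4 * (+ n * + n) + + 6 * + n + + 2 + (+ 1 + -1ℤ ^ n) * (+ 1 - + 2 * + t n))
      × (+ 4 * + sumUpTo b n ≡ + 4 * (+ n * + n) + + 6 * + n + + 2 + (+ 1 + -1ℤ ^ n) * (+ 2 * + t n - + 1))
corollary3p3 t a b isThueMorse a-enumerates b-enumerates n =
  trans (cong +_ (a≡nthOdious n)) (nthOdious-ℤ n) ,
  trans (cong +_ (b≡nthEvil n)) (nthEvil-ℤ n) ,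
  trans (cong (λ S → + 4 * + S) (sumUpTo-cong a≡nthOdious n)) (four-sumUpTo-nthOdious n) ,
  trans (cong (λ R → + 4 * + R) (sumUpTo-cong b≡nthEvil n)) (four-sumUpTo-nthEvil n)
  where
  open ThueMorse isThueMorse
  a≡nthOdious : ∀ k → a k ≡ nthOdious k
  a≡nthOdious = IncreasingEnumeration-unique a-enumerates odious-enumeration
  b≡nthEvil : ∀ k → b k ≡ nthEvil k
  b≡nthEvil = IncreasingEnumeration-unique b-enumerates evil-enumeration
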